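{- A context tree $\mathcal{T}$ over $A=\{a_1,\dots,a_n\}$ has perfect memory if and only if both of the following hold: (1) $\mathcal{T}$ is complete; and (2) for every $i\in\{1,\dots,n\}$ and every string $c_i$ such that $\overline{c_ia_i}\in\mathcal{T}^*$, there exists $u\in\mathcal{T}^*$ with $c_i\prec u$.
   Context: Strings are finite sequences (possibly empty) of letters of the finite alphabet $A$; $\overline{uv}$ is concatenation; $v\prec s$ ($v$ is a postfix of $s$) if $s=\overline{wv}$ for some string $w$. A context tree over $A$ is a finite rooted tree whose non-root vertices are labeled by letters of $A$, no two siblings having the same label; a context is the string read along the path from a leaf to the root (leaf's label first, label of the root's child last), and $\mathcal{T}^*$ is the set of contexts. $\mathcal{T}$ is complete if every node is a leaf or has exactly $n$ children. $\mathcal{T}$ has perfect memory if for every $c\in\mathcal{T}^*$ and every $i$ there exists $u\in\mathcal{T}^*$ with $u\prec\overline{ca_i}$. -}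

module Defs where

open import Data.Nat using (ℕ)
open import Data.Fin using (Fin)
open import Data.List using (List; []; _∷_; _++_; _∷ʳ_; reverse)
open import Data.Maybe using (Maybe; just; nothing; Is-just)
open import Data.Product using (Σ; ∃; _×_; _,_)
open import Data.Sum using (_⊎_)
open import Relation.Binary.PropositionalEquality using (_≡_)

-- The alphabet A = {a_1,…,a_n} is represented by Fin n (letter a_i ↔ index i).
-- Strings over A are lists of letters; concatenation is _++_.
Str : ℕ → Set
Str n = List (Fin n)

_≺_ : ∀ {n} → Str n → Str n → Set
v ≺ s = ∃ λ w → s ≡ w ++ v

-- A context tree over A: a finite rooted tree; each vertex has, for each
-- letter a, at most one child labelled a (so no two siblings share a label).
-- Inductivity + finite branching make it finite.
data CTree (n : ℕ) : Set where
  node : (Fin n → Maybe (CTree n)) → CTree n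

children : ∀ {n} → CTree n → Fin n → Maybe (CTree n)
children (node f) = f

IsLeaf : ∀ {n} → CTree n → Set
IsLeaf t = ∀ a → children t a ≡ nothing

data LeafPath {n : ℕ} : CTree n → Str n → Set where
  atLeaf : ∀ {t} → IsLeaf t → LeafPath t []
  step   : ∀ {t t' a p} → children t a ≡ just t' → LeafPath t' p → LeafPath t (a ∷ p)

-- c ∈ T* : c is read from the leaf to the root (leaf's label first,
-- label of the root's child last).
Ctx : ∀ {n} → CTree n → Str n → Set
Ctx t c = LeafPath t (reverse c)

-- Complete: every node is a leaf or has exactly n children (i.e. a child
-- for every letter, since sibling labels are distinct).
data Complete {n : ℕ} : CTree n → Set where
  complete : ∀ {f} →
    (IsLeaf (node f) ⊎ (∀ a → Is-just (f a))) →
    (∀ a t' → f a ≡ just t' → Complete t') →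
    Complete (node f)

PerfectMemory : ∀ {n} → CTree n → Set
PerfectMemory {n} t = ∀ (c : Str n) (i : Fin n) → Ctx t c →
  Σ (Str n) λ u → Ctx t u × (u ≺ (c ∷ʳ i))

Condition2 : ∀ {n} → CTree n → Set
Condition2 {n} t = ∀ (i : Fin n) (ci : Str n) → Ctx t (ci ∷ʳ i) →
  Σ (Str n) λ u → Ctx t u × (ci ≺ u)

-- Read from the root, a context c is the leaf path reverse c, and the postfix order on
-- contexts becomes the prefix order on paths.  A tree is complete iff every string either
-- runs into a leaf or ends at a node of the tree.  Perfect memory says that i p runs into
-- a leaf for every leaf path p and letter i; prepending letters one at a time, every string
-- then runs into a leaf or ends inside the tree, so the tree is complete.  The rest rests
-- on the fact that a walk cannot continue past a leaf.  If i p is a leaf path and p runs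
-- into a leaf at a prefix r, then i r runs into a leaf as well, so the leaf path i p cannot
-- continue past i r: p = r, and p ends inside the tree, which is condition (2).
-- Conversely, if i p ends at a node of a complete tree, extend it to a leaf path i p s;
-- condition (2) puts p s inside the tree, which forces s = [] because p is a leaf path.
module Submission where

open import Defs
open import Data.Nat using (ℕ; zero; suc)
open import Data.Fin using (Fin; zero; suc)
open import Data.List using ([]; _∷_; _++_; _∷ʳ_; reverse; [_])
open import Data.List.Properties using (reverse-involutive; reverse-++; ++-identityʳ)
open import Data.Maybe using (Maybe; just; nothing; Is-just)
open import Data.Maybe.Relation.Unary.Any using (just)
open import Data.Product using (_×_; Σ; ∃; ∃₂; _,_; proj₂)
open import Data.Product.Function.NonDependent.Propositional using (_×-⇔_)
open import Data.Sum using (_⊎_; inj₁; inj₂)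
open import Data.Empty using (⊥; ⊥-elim)
open import Function.Bundles using (_⇔_; mk⇔; Equivalence)
open import Function.Related.Propositional using (module EquationalReasoning)
open import Function.Properties.Equivalence using () renaming (sym to ⇔-sym)
open import Relation.Binary.PropositionalEquality
  using (_≡_; refl; sym; trans; cong; subst; module ≡-Reasoning)

all-nothing⊎any-just : ∀ {X : Set} {m} (f : Fin m → Maybe X) →
  (∀ a → f a ≡ nothing) ⊎ ∃₂ λ a x → f a ≡ just x
all-nothing⊎any-just {m = zero} f = inj₁ λ ()
all-nothing⊎any-just {m = suc m} f with f zero in e
... | just x = inj₂ (zero , x , e)
... | nothing with all-nothing⊎any-just (λ a → f (suc a))
...   | inj₁ none = inj₁ λ { zero → e ; (suc a) → none a }
...   | inj₂ (a , x , e′) = inj₂ (suc a , x , e′)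

just≢nothing : ∀ {X : Set} {m : Maybe X} {x} → m ≡ just x → m ≡ nothing → ⊥
just≢nothing refl ()

module _ {n : ℕ} where

  CTree-induction : (P : CTree n → Set) →
    (∀ f → (∀ a t′ → f a ≡ just t′ → P t′) → P (node f)) →
    ∀ t → P t
  CTree-induction P case-node (node f) = case-node f (λ a t′ → below (f a))
    where
    below : (m : Maybe (CTree n)) → ∀ {t′} → m ≡ just t′ → P t′
    below (just t) refl = CTree-induction P case-node t

  Prefix : Str n → Str n → Set
  Prefix r q = ∃ λ w → q ≡ r ++ w

  data HitsLeaf : CTree n → Str n → Set where
    hitLeaf : ∀ {t q} → IsLeaf t → HitsLeaf t q
    hitStep : ∀ {t t′ a q} → children t a ≡ just t′ → HitsLeaf t′ q → HitsLeaf t (a ∷ q)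

  data Reaches : CTree n → Str n → CTree n → Set where
    here  : ∀ {t} → Reaches t [] t
    there : ∀ {t t′ t″ a q} → children t a ≡ just t′ → Reaches t′ q t″ → Reaches t (a ∷ q) t″

  leafPath-exists : ∀ t → ∃ (LeafPath t)
  leafPath-exists = CTree-induction (λ t → ∃ (LeafPath t)) extend
    where
    extend : ∀ f → (∀ a t′ → f a ≡ just t′ → ∃ (LeafPath t′)) → ∃ (LeafPath (node f))
    extend f below with all-nothing⊎any-just f
    ... | inj₁ none = [] , atLeaf none
    ... | inj₂ (a , t′ , e) with below a t′ e
    ...   | p , lp = a ∷ p , step e lp

  leafPath⇒hitsLeaf : ∀ {t p} → LeafPath t p → HitsLeaf t p
  leafPath⇒hitsLeaf (atLeaf leaf) = hitLeaf leaf
  leafPath⇒hitsLeaf (step e lp)   = hitStep e (leafPath⇒hitsLeaf lp)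

  hitsLeaf-++ : ∀ {t q} w → HitsLeaf t q → HitsLeaf t (q ++ w)
  hitsLeaf-++ w (hitLeaf leaf) = hitLeaf leaf
  hitsLeaf-++ w (hitStep e h)  = hitStep e (hitsLeaf-++ w h)

  hitsLeaf⇔leafPath-prefix : ∀ {t q} → HitsLeaf t q ⇔ (∃ λ r → LeafPath t r × Prefix r q)
  hitsLeaf⇔leafPath-prefix = mk⇔ to from
    where
    to : ∀ {t q} → HitsLeaf t q → ∃ λ r → LeafPath t r × Prefix r q
    to {q = q} (hitLeaf leaf) = [] , atLeaf leaf , q , refl
    to (hitStep {a = a} e h) with to h
    ... | r , lp , w , eq = a ∷ r , step e lp , w , cong (a ∷_) eq
    from : ∀ {t q} → (∃ λ r → LeafPath t r × Prefix r q) → HitsLeaf t q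
    from (r , lp , w , refl) = hitsLeaf-++ w (leafPath⇒hitsLeaf lp)

  reaches-leafPath : ∀ {t q t′ s} → Reaches t q t′ → LeafPath t′ s → LeafPath t (q ++ s)
  reaches-leafPath here        lp = lp
  reaches-leafPath (there e r) lp = step e (reaches-leafPath r lp)

  reaches-leaf⇒hitsLeaf : ∀ {t q t′} → Reaches t q t′ → IsLeaf t′ → HitsLeaf t q
  reaches-leaf⇒hitsLeaf here        leaf = hitLeaf leaf
  reaches-leaf⇒hitsLeaf (there e r) leaf = hitStep e (reaches-leaf⇒hitsLeaf r leaf)

  leafPath-++⇒reaches : ∀ {t} q {w} → LeafPath t (q ++ w) → ∃ (Reaches t q)
  leafPath-++⇒reaches []      lp          = _ , here
  leafPath-++⇒reaches (a ∷ q) (step e lp) with leafPath-++⇒reaches q lp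
  ... | t″ , r = t″ , there e r

  leafPath⇒reaches : ∀ {t p} → LeafPath t p → ∃ (Reaches t p)
  leafPath⇒reaches (atLeaf _)  = _ , here
  leafPath⇒reaches (step e lp) with leafPath⇒reaches lp
  ... | t″ , r = t″ , there e r

  hitsLeaf-++⁻ : ∀ {t} q s → HitsLeaf t (q ++ s) → HitsLeaf t q ⊎ ∃ (Reaches t q)
  hitsLeaf-++⁻ []      s h              = inj₂ (_ , here)
  hitsLeaf-++⁻ (a ∷ q) s (hitLeaf leaf) = inj₁ (hitLeaf leaf)
  hitsLeaf-++⁻ (a ∷ q) s (hitStep e h) with hitsLeaf-++⁻ q s h
  ... | inj₁ h′       = inj₁ (hitStep e h′)
  ... | inj₂ (t″ , r) = inj₂ (t″ , there e r)

  hitsLeaf-reaches-++ : ∀ {t q w t′} → HitsLeaf t q → Reaches t (q ++ w) t′ → w ≡ []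
  hitsLeaf-reaches-++ {q = []}    (hitLeaf leaf) here        = refl
  hitsLeaf-reaches-++ {q = []}    (hitLeaf leaf) (there e _) = ⊥-elim (just≢nothing e (leaf _))
  hitsLeaf-reaches-++ {q = _ ∷ _} (hitLeaf leaf) (there e _) = ⊥-elim (just≢nothing e (leaf _))
  hitsLeaf-reaches-++ (hitStep e h) (there e′ r) with trans (sym e) e′
  ... | refl = hitsLeaf-reaches-++ h r

  Total : CTree n → Set
  Total t = ∀ q → HitsLeaf t q ⊎ ∃ (Reaches t q)

  complete⇒total : ∀ {t} → Complete t → Total t
  complete⇒total c [] = inj₂ (_ , here)
  complete⇒total (complete (inj₁ leaf) _) (a ∷ q) = inj₁ (hitLeaf leaf)
  complete⇒total {node f} (complete (inj₂ full) sub) (a ∷ q) with f a in e | full a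
  ... | just t′ | _ with complete⇒total (sub a t′ e) q
  ...   | inj₁ h       = inj₁ (hitStep e h)
  ...   | inj₂ (_ , r) = inj₂ (_ , there e r)

  total-child : ∀ {t a t′} → Total t → children t a ≡ just t′ → Total t′
  total-child {a = a} tot e q with tot (a ∷ q)
  ... | inj₁ (hitLeaf leaf) = ⊥-elim (just≢nothing e (leaf _))
  ... | inj₁ (hitStep e′ h) with trans (sym e) e′
  ...   | refl = inj₁ h
  total-child tot e q | inj₂ (_ , there e′ r) with trans (sym e) e′
  ...   | refl = inj₂ (_ , r)

  total⇒leaf-or-full : ∀ {f} → Total (node f) → IsLeaf (node f) ⊎ (∀ a → Is-just (f a))
  total⇒leaf-or-full {f} tot with all-nothing⊎any-just f
  ... | inj₁ none = inj₁ none
  ... | inj₂ (a , _ , e) = inj₂ has-child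
    where
    has-child : ∀ b → Is-just (f b)
    has-child b with tot [ b ]
    ... | inj₁ (hitLeaf leaf)      = ⊥-elim (just≢nothing e (leaf _))
    ... | inj₁ (hitStep e′ _)      = subst Is-just (sym e′) (just _)
    ... | inj₂ (_ , there e′ here) = subst Is-just (sym e′) (just _)

  total⇒complete : ∀ t → Total t → Complete t
  total⇒complete = CTree-induction (λ t → Total t → Complete t) λ f below tot →
    complete (total⇒leaf-or-full tot) (λ a t′ e → below a t′ e (total-child tot e))

  complete⇔total : ∀ {t} → Complete t ⇔ Total t
  complete⇔total {t} = mk⇔ complete⇒total (total⇒complete t)

  PathPerfectMemory : CTree n → Set
  PathPerfectMemory t = ∀ i p → LeafPath t p → HitsLeaf t (i ∷ p)

  PathCondition2 : CTree n → Set
  PathCondition2 t = ∀ i p → LeafPath t (i ∷ p) → ∃ (Reaches t p)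

  pathPerfectMemory⇒total : ∀ {t} → PathPerfectMemory t → Total t
  pathPerfectMemory⇒total pm [] = inj₂ (_ , here)
  pathPerfectMemory⇒total pm (i ∷ q) with pathPerfectMemory⇒total pm q
  ... | inj₁ h with Equivalence.to hitsLeaf⇔leafPath-prefix h
  ...   | r , lp , w , refl = inj₁ (hitsLeaf-++ w (pm i r lp))
  pathPerfectMemory⇒total pm (i ∷ q) | inj₂ (t′ , r) with leafPath-exists t′
  ... | s , lp = hitsLeaf-++⁻ (i ∷ q) s (pm i (q ++ s) (reaches-leafPath r lp))

  pathPerfectMemory⇒pathCondition2 : ∀ {t} → PathPerfectMemory t → PathCondition2 t
  pathPerfectMemory⇒pathCondition2 {t} pm i p lp with pathPerfectMemory⇒total pm p
  ... | inj₂ r = r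
  ... | inj₁ h with Equivalence.to hitsLeaf⇔leafPath-prefix h
  ...   | r , lpr , w , refl
          with hitsLeaf-reaches-++ (pm i r lpr) (proj₂ (leafPath⇒reaches lp))
  ...     | refl = subst (λ q → ∃ (Reaches t q)) (sym (++-identityʳ r)) (leafPath⇒reaches lpr)

  total×pathCondition2⇒pathPerfectMemory : ∀ {t} → Total t → PathCondition2 t → PathPerfectMemory t
  total×pathCondition2⇒pathPerfectMemory tot c2 i p lp with tot (i ∷ p)
  ... | inj₁ h = h
  ... | inj₂ (t′ , r) with leafPath-exists t′
  ...   | s , lp′ with c2 i (p ++ s) (reaches-leafPath r lp′)
  ...     | _ , r′ with hitsLeaf-reaches-++ (leafPath⇒hitsLeaf lp) r′
  ...       | refl with lp′
  ...         | atLeaf leaf = reaches-leaf⇒hitsLeaf r leaf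

  pathPerfectMemory⇔total×pathCondition2 : ∀ {t} →
    PathPerfectMemory t ⇔ (Total t × PathCondition2 t)
  pathPerfectMemory⇔total×pathCondition2 = mk⇔
    (λ pm → pathPerfectMemory⇒total pm , pathPerfectMemory⇒pathCondition2 pm)
    (λ (tot , c2) → total×pathCondition2⇒pathPerfectMemory tot c2)

  reverse-∷ʳ : ∀ (c : Str n) i → reverse (c ∷ʳ i) ≡ i ∷ reverse c
  reverse-∷ʳ c i = reverse-++ c [ i ]

  ≺⇒prefix-reverse : ∀ {v s : Str n} → v ≺ s → Prefix (reverse v) (reverse s)
  ≺⇒prefix-reverse {v} (w , refl) = reverse w , reverse-++ w v

  prefix-reverse⇒≺ : ∀ {r : Str n} {s} → Prefix r (reverse s) → reverse r ≺ s
  prefix-reverse⇒≺ {r} {s} (w , eq) = reverse w , (begin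
    s                     ≡⟨ reverse-involutive s ⟨
    reverse (reverse s)   ≡⟨ cong reverse eq ⟩
    reverse (r ++ w)      ≡⟨ reverse-++ r w ⟩
    reverse w ++ reverse r ∎)
    where open ≡-Reasoning

  reverse-onto : {P : Str n → Set} → (∀ c → P (reverse c)) → ∀ p → P p
  reverse-onto {P} h p = subst P (reverse-involutive p) (h (reverse p))

  leafPath⇒ctx : ∀ {t : CTree n} {r} → LeafPath t r → Ctx t (reverse r)
  leafPath⇒ctx {t} {r} = subst (LeafPath t) (sym (reverse-involutive r))

  ctx-postfix⇔hitsLeaf : ∀ {t : CTree n} {s} → (Σ (Str n) λ u → Ctx t u × u ≺ s) ⇔ HitsLeaf t (reverse s)
  ctx-postfix⇔hitsLeaf = mk⇔
    (λ (u , cu , u≺s) → Equivalence.from hitsLeaf⇔leafPath-prefix (_ , cu , ≺⇒prefix-reverse u≺s))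
    (λ h → let r , lp , pre = Equivalence.to hitsLeaf⇔leafPath-prefix h
           in reverse r , leafPath⇒ctx lp , prefix-reverse⇒≺ pre)

  ctx-extension⇔reaches : ∀ {t : CTree n} {c} → (Σ (Str n) λ u → Ctx t u × c ≺ u) ⇔ ∃ (Reaches t (reverse c))
  ctx-extension⇔reaches {t} {c} = mk⇔ to from
    where
    to : (Σ (Str n) λ u → Ctx t u × c ≺ u) → ∃ (Reaches t (reverse c))
    to (u , cu , c≺u) with ≺⇒prefix-reverse c≺u
    ... | w , eq = leafPath-++⇒reaches (reverse c) (subst (LeafPath t) eq cu)
    from : ∃ (Reaches t (reverse c)) → Σ (Str n) λ u → Ctx t u × c ≺ u
    from (t′ , r) with leafPath-exists t′
    ... | s , lp = reverse (reverse c ++ s) , leafPath⇒ctx (reaches-leafPath r lp) ,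
                   reverse s , trans (reverse-++ (reverse c) s) (cong (reverse s ++_) (reverse-involutive c))

  perfectMemory⇔pathPerfectMemory : ∀ {t : CTree n} → PerfectMemory t ⇔ PathPerfectMemory t
  perfectMemory⇔pathPerfectMemory {t} = mk⇔
    (λ pm i → reverse-onto λ c cc →
      subst (HitsLeaf t) (reverse-∷ʳ c i) (Equivalence.to ctx-postfix⇔hitsLeaf (pm c i cc)))
    (λ pm c i cc →
      Equivalence.from ctx-postfix⇔hitsLeaf (subst (HitsLeaf t) (sym (reverse-∷ʳ c i)) (pm i (reverse c) cc)))

  condition2⇔pathCondition2 : ∀ {t : CTree n} → Condition2 t ⇔ PathCondition2 t
  condition2⇔pathCondition2 {t} = mk⇔
    (λ c2 i → reverse-onto λ c lp →
      Equivalence.to ctx-extension⇔reaches (c2 i c (subst (LeafPath t) (sym (reverse-∷ʳ c i)) lp)))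
    (λ c2 i c cc →
      Equivalence.from ctx-extension⇔reaches (c2 i (reverse c) (subst (LeafPath t) (reverse-∷ʳ c i) cc)))

corollary1 : (n : ℕ) (t : CTree n) →
    PerfectMemory t ⇔ (Complete t × Condition2 t)
corollary1 n t = begin
  PerfectMemory t               ∼⟨ perfectMemory⇔pathPerfectMemory ⟩
  PathPerfectMemory t           ∼⟨ pathPerfectMemory⇔total×pathCondition2 ⟩
  (Total t × PathCondition2 t)  ∼⟨ ⇔-sym complete⇔total ×-⇔ ⇔-sym condition2⇔pathCondition2 ⟩
  (Complete t × Condition2 t)   ∎
  where open EquationalReasoning
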